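{- For $5\le n\le 6$, $\kappa(Q_n;K_{1,5})=\kappa^s(Q_n;K_{1,5})=3$.
   Context: The $n$-dimensional hypercube $Q_n$ has as vertices all binary strings of length $n$, two strings being adjacent iff they differ in exactly one position. $K_{1,r}$ denotes the star with $r$ leaves. For a graph $G$ and a set $F$ of subgraphs of $G$, $G-F$ denotes the graph obtained from $G$ by deleting all vertices of all members of $F$. For a connected graph $T$, $\kappa(G;T)$ is the minimum cardinality of a set $F$ of subgraphs of $G$, each isomorphic to $T$, such that $G-F$ is disconnected; $\kappa^s(G;T)$ is the minimum cardinality of a set $F$ of subgraphs of $G$, each isomorphic to a connected subgraph of $T$, such that $G-F$ is disconnected. -}

module Defs where

open import Data.Nat using (ℕ; zero; suc; _+_; _≤_; _<_)
open import Data.Bool using (Bool; true; false)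
open import Data.Vec using (Vec; []; _∷_)
open import Data.List using (List; length)
open import Data.List.Membership.Propositional using (_∈_)
open import Data.List.Relation.Unary.All using (All)
open import Data.List.Relation.Unary.Any using (Any)
open import Data.List.Relation.Unary.Unique.Propositional using (Unique)
open import Data.List.Relation.Unary.AllPairs using (AllPairs)
open import Data.Product using (Σ; ∃; ∃-syntax; _×_; _,_; proj₂)
open import Data.Sum using (_⊎_)
open import Relation.Nullary using (¬_)
open import Relation.Binary.PropositionalEquality using (_≡_)
open import Relation.Binary.Construct.Closure.ReflexiveTransitive using (Star)

Vertex : ℕ → Set
Vertex n = Vec Bool n

hamming : ∀ {n} → Vertex n → Vertex n → ℕ
hamming []       []       = 0
hamming (true  ∷ x) (true  ∷ y) = hamming x y
hamming (false ∷ x) (false ∷ y) = hamming x y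
hamming (true  ∷ x) (false ∷ y) = suc (hamming x y)
hamming (false ∷ x) (true  ∷ y) = suc (hamming x y)

Adj : ∀ {n} → Vertex n → Vertex n → Set
Adj x y = hamming x y ≡ 1

-- A subgraph of Q_n isomorphic to K_{1,r} is given by a centre and r
-- distinct neighbours of it (the leaves); its edges are centre--leaf.
-- For r = 0 this is a single vertex (K_1).

record StarSub (n r : ℕ) : Set where
  field
    center   : Vertex n
    leaves   : List (Vertex n)
    distinct : Unique leaves
    size     : length leaves ≡ r
    adjacent : All (Adj center) leaves
open StarSub public

InStar : ∀ {n r} → StarSub n r → Vertex n → Set
InStar s x = x ≡ center s ⊎ x ∈ leaves s

EdgeOf : ∀ {n r} → StarSub n r → Vertex n → Vertex n → Set
EdgeOf s x y = (x ≡ center s × y ∈ leaves s) ⊎ (y ≡ center s × x ∈ leaves s)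

_↔′_ : Set → Set → Set
A ↔′ B = (A → B) × (B → A)

SameSub : ∀ {n r r′} → StarSub n r → StarSub n r′ → Set
SameSub s t = (∀ x → InStar s x ↔′ InStar t x)
            × (∀ x y → EdgeOf s x y ↔′ EdgeOf t x y)

-- Subgraphs isomorphic to a connected subgraph of K_{1,k}:
-- these are (up to isomorphism) K_1 = K_{1,0} and K_{1,r}, 1 ≤ r ≤ k.
SubStar : ℕ → ℕ → Set
SubStar n k = Σ ℕ λ r → r ≤ k × StarSub n r

subStar : ∀ {n k} → SubStar n k → Σ ℕ (StarSub n)
subStar (r , _ , s) = r , s

Disconnected : ∀ {n} → (Vertex n → Set) → Set
Disconnected {n} Removed =
  ∃[ u ] ∃[ v ] (¬ Removed u × ¬ Removed v
    × ¬ Star (λ a b → Adj a b × ¬ Removed a × ¬ Removed b) u v)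

-- A set F of subgraphs is a
-- duplicate-free list; |F| is its length.
MinCut : ∀ {n} {S : Set} → (S → Vertex n → Set) → (S → S → Set) → ℕ → Set
MinCut {n} {S} V Same m =
  (∃[ F ] (length F ≡ m × AllPairs (λ s t → ¬ Same s t) F
           × Disconnected (λ x → Any (λ s → V s x) F)))
  × (∀ (F : List S) → AllPairs (λ s t → ¬ Same s t) F → length F < m
       → ¬ Disconnected (λ x → Any (λ s → V s x) F))

κStar≡ : ℕ → ℕ → ℕ → Set
κStar≡ n k m = MinCut {n} {StarSub n k} InStar SameSub m

κˢStar≡ : ℕ → ℕ → ℕ → Set
κˢStar≡ n k m =
  MinCut {n} {SubStar n k}
    (λ s → InStar (proj₂ (proj₂ s)))
    (λ s t → SameSub (proj₂ (proj₂ s))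
                     (proj₂ (proj₂ t)))
    m

-- Every star K_{1,r} of Q_n lies in the closed unit ball around its centre.  For n ∈ {5, 6},
-- deleting any set contained in two unit balls leaves all surviving vertices other than the two
-- centres in one component: each of them walks to a common root through vertices at distance ≥ 2
-- from both centres.  The translations x ↦ x ⊕ d are automorphisms of Q_n, so one centre may be
-- taken to be 0, and the remaining finite claim is settled by evaluating a search that returns the
-- walks. Hence at most two stars never disconnect Q_n.  Conversely, three stars centred at e₀+e₁,
-- e₂+e₃ and e₀+e₄ (n = 5) or e₄+e₅ (n = 6) cover every neighbour of 0 but neither 0 nor 1⋯1,
-- isolating 0.
module Submission where

open import Defs
open import Data.Nat using (ℕ; zero; suc; _+_; _≤_; _<_; z≤n; s≤s; _≤?_; _<?_)
import Data.Nat as ℕ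
open import Data.Nat.Properties using (≤-refl; ≤-reflexive; ≤⇒≯)
open import Data.Bool using (true; false; not; _xor_; if_then_else_)
import Data.Bool as Bool
open import Data.Bool.Properties using (not-¬)
open import Data.Fin using (Fin; zero; suc; #_)
import Data.Fin as Fin
open import Data.Vec using ([]; _∷_; replicate; zipWith; _[_]%=_)
open import Data.Vec.Properties using (≡-dec; ∷-injectiveˡ; ∷-injectiveʳ)
open import Data.List using (List; []; _∷_; length; map; allFin)
open import Data.List.Properties using (length-map)
open import Data.List.Relation.Unary.Any using (Any; here; there; any?; satisfied)
import Data.List.Relation.Unary.Any as Any
import Data.List.Relation.Unary.Any.Properties as Any
import Data.List.Relation.Unary.All as All
import Data.List.Relation.Unary.All.Properties as All
open import Data.List.Relation.Unary.AllPairs using (AllPairs; allPairs?)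
import Data.List.Relation.Unary.AllPairs as AllPairs
import Data.List.Relation.Unary.AllPairs.Properties as AllPairs
import Data.List.Relation.Unary.Unique.Propositional.Properties as Unique
open import Data.List.Membership.Propositional using (_∈_)
open import Data.Maybe using (Maybe; just; nothing; Is-just; to-witness; _>>=_; _<∣>_)
import Data.Maybe as Maybe
open import Data.Maybe.Relation.Unary.Any using (dec)
open import Data.Product using (∃; ∃-syntax; _×_; _,_; proj₁; proj₂; map₂)
open import Data.Sum using (_⊎_; inj₁; inj₂)
open import Data.Unit using (tt)
open import Data.Empty using (⊥-elim)
open import Function using (_∘_; Injective)
open import Relation.Binary using (DecidableEquality)
open import Relation.Binary.PropositionalEquality
open import Relation.Binary.Construct.Closure.ReflexiveTransitive using (Star; ε; _◅_; _◅◅_; gmap; reverse)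
open import Relation.Nullary using (¬_; Dec; yes; no; does)
open import Relation.Nullary.Decidable
  using (True; toWitness; from-yes; ¬?; _×-dec_; _⊎-dec_; _→-dec_; map′; dec⇒maybe)
open import Relation.Unary using (Decidable)

_≟ᵥ_ : ∀ {n} → DecidableEquality (Vertex n)
_≟ᵥ_ = ≡-dec Bool._≟_

zeros ones : ∀ {n} → Vertex n
zeros = replicate _ false
ones = replicate _ true

_⊕_ : ∀ {n} → Vertex n → Vertex n → Vertex n
_⊕_ = zipWith _xor_

toggle : ∀ {n} → Vertex n → Fin n → Vertex n
toggle x i = x [ i ]%= not

basis : ∀ {n} → Fin n → Vertex n
basis = toggle zeros

hamming-self : ∀ {n} (x : Vertex n) → hamming x x ≡ 0
hamming-self [] = refl
hamming-self (true ∷ x) = hamming-self x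
hamming-self (false ∷ x) = hamming-self x

hamming-sym : ∀ {n} (x y : Vertex n) → hamming x y ≡ hamming y x
hamming-sym [] [] = refl
hamming-sym (true ∷ x) (true ∷ y) = hamming-sym x y
hamming-sym (false ∷ x) (false ∷ y) = hamming-sym x y
hamming-sym (true ∷ x) (false ∷ y) = cong suc (hamming-sym x y)
hamming-sym (false ∷ x) (true ∷ y) = cong suc (hamming-sym x y)

Adj-sym : ∀ {n} {x y : Vertex n} → Adj x y → Adj y x
Adj-sym {x = x} {y} adj = trans (hamming-sym y x) adj

hamming-toggle : ∀ {n} (x : Vertex n) i → hamming x (toggle x i) ≡ 1
hamming-toggle (true ∷ x) zero = cong suc (hamming-self x)
hamming-toggle (false ∷ x) zero = cong suc (hamming-self x)
hamming-toggle (true ∷ x) (suc i) = hamming-toggle x i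
hamming-toggle (false ∷ x) (suc i) = hamming-toggle x i

toggle-injective : ∀ {n} (x : Vertex n) → Injective _≡_ _≡_ (toggle x)
toggle-injective (a ∷ x) {zero} {zero} _ = refl
toggle-injective (a ∷ x) {zero} {suc j} eq = ⊥-elim (not-¬ refl (sym (∷-injectiveˡ eq)))
toggle-injective (a ∷ x) {suc i} {zero} eq = ⊥-elim (not-¬ refl (∷-injectiveˡ eq))
toggle-injective (a ∷ x) {suc i} {suc j} eq = cong suc (toggle-injective x (∷-injectiveʳ eq))

hamming-⊕ : ∀ {n} (x y d : Vertex n) → hamming (x ⊕ d) (y ⊕ d) ≡ hamming x y
hamming-⊕ [] [] [] = refl
hamming-⊕ (true ∷ x) (true ∷ y) (true ∷ d) = hamming-⊕ x y d
hamming-⊕ (true ∷ x) (true ∷ y) (false ∷ d) = hamming-⊕ x y d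
hamming-⊕ (false ∷ x) (false ∷ y) (true ∷ d) = hamming-⊕ x y d
hamming-⊕ (false ∷ x) (false ∷ y) (false ∷ d) = hamming-⊕ x y d
hamming-⊕ (true ∷ x) (false ∷ y) (true ∷ d) = cong suc (hamming-⊕ x y d)
hamming-⊕ (true ∷ x) (false ∷ y) (false ∷ d) = cong suc (hamming-⊕ x y d)
hamming-⊕ (false ∷ x) (true ∷ y) (true ∷ d) = cong suc (hamming-⊕ x y d)
hamming-⊕ (false ∷ x) (true ∷ y) (false ∷ d) = cong suc (hamming-⊕ x y d)

⊕-involutive : ∀ {n} (x d : Vertex n) → (x ⊕ d) ⊕ d ≡ x
⊕-involutive [] [] = refl
⊕-involutive (true ∷ x) (true ∷ d) = cong (true ∷_) (⊕-involutive x d)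
⊕-involutive (true ∷ x) (false ∷ d) = cong (true ∷_) (⊕-involutive x d)
⊕-involutive (false ∷ x) (true ∷ d) = cong (false ∷_) (⊕-involutive x d)
⊕-involutive (false ∷ x) (false ∷ d) = cong (false ∷_) (⊕-involutive x d)

⊕-identityˡ : ∀ {n} (d : Vertex n) → zeros ⊕ d ≡ d
⊕-identityˡ [] = refl
⊕-identityˡ (a ∷ d) = cong (a ∷_) (⊕-identityˡ d)

⊕-self : ∀ {n} (d : Vertex n) → d ⊕ d ≡ zeros
⊕-self [] = refl
⊕-self (true ∷ d) = cong (false ∷_) (⊕-self d)
⊕-self (false ∷ d) = cong (false ∷_) (⊕-self d)

⊕-cancelʳ : ∀ {n} {x y : Vertex n} d → x ⊕ d ≡ y ⊕ d → x ≡ y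
⊕-cancelʳ {x = x} {y} d eq = begin
  x            ≡⟨ ⊕-involutive x d ⟨
  (x ⊕ d) ⊕ d  ≡⟨ cong (_⊕ d) eq ⟩
  (y ⊕ d) ⊕ d  ≡⟨ ⊕-involutive y d ⟩
  y            ∎
  where open ≡-Reasoning

all-vertices? : ∀ {n} {P : Vertex n → Set} → Decidable P → Dec (∀ x → P x)
all-vertices? {zero} P? = map′ (λ { p [] → p }) (λ p → p []) (P? [])
all-vertices? {suc n} P? =
  map′ (λ { (p , q) (true ∷ x) → p x ; (p , q) (false ∷ x) → q x })
       (λ p → (λ x → p (true ∷ x)) , (λ x → p (false ∷ x)))
       (all-vertices? (P? ∘ (true ∷_)) ×-dec all-vertices? (P? ∘ (false ∷_)))

Far : ∀ {n} → Vertex n → Vertex n → Set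
Far c x = 2 ≤ hamming c x

-- Only the target of an escape step must avoid the balls, so a walk may start inside one.
Escape : ∀ {n} → Vertex n → Vertex n → Vertex n → Vertex n → Set
Escape c₁ c₂ a b = Adj a b × Far c₁ b × Far c₂ b

Escapable : ℕ → Set
Escapable n = ∀ (c₁ c₂ : Vertex n) → ∃[ r ] ∀ u → u ≢ c₁ → u ≢ c₂ → Star (Escape c₁ c₂) u r

escape-⊕ : ∀ {n} {c₁ c₂ a b : Vertex n} d → Escape c₁ c₂ a b → Escape (c₁ ⊕ d) (c₂ ⊕ d) (a ⊕ d) (b ⊕ d)
escape-⊕ {c₁ = c₁} {c₂} {a} {b} d rewrite hamming-⊕ a b d | hamming-⊕ c₁ b d | hamming-⊕ c₂ b d = λ e → e

escapable-from-origin : ∀ {n}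
  → (∀ (c : Vertex n) → ∃[ r ] ∀ u → u ≢ zeros → u ≢ c → Star (Escape zeros c) u r)
  → Escapable n
escapable-from-origin escape c₁ c₂ = proj₁ (escape c) ⊕ c₁ , reach
  where
  c = c₂ ⊕ c₁
  translate : ∀ {a b} → Escape zeros c a b → Escape c₁ c₂ (a ⊕ c₁) (b ⊕ c₁)
  translate {a} {b} e = subst₂ (λ x y → Escape x y (a ⊕ c₁) (b ⊕ c₁)) (⊕-identityˡ c₁) (⊕-involutive c₂ c₁)
    (escape-⊕ {c₁ = zeros} {c} {a} {b} c₁ e)
  reach : ∀ u → u ≢ c₁ → u ≢ c₂ → Star (Escape c₁ c₂) u (proj₁ (escape c) ⊕ c₁)
  reach u u≢c₁ u≢c₂ = subst (λ x → Star (Escape c₁ c₂) x (proj₁ (escape c) ⊕ c₁)) (⊕-involutive u c₁)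
    (gmap (_⊕ c₁) (λ {a} {b} → translate {a} {b}) (proj₂ (escape c) (u ⊕ c₁)
      (u≢c₁ ∘ ⊕-cancelʳ c₁ ∘ (λ eq → trans eq (sym (⊕-self c₁))))
      (u≢c₂ ∘ ⊕-cancelʳ c₁)))

-- A greedy search for escape walks.  Its output is a checked walk, so nothing needs to be proved
-- about the heuristic; a fuel of 14 steps happens to suffice for n ≤ 6.

neighbours : ∀ {n} → Vertex n → List (Vertex n)
neighbours [] = []
neighbours (a ∷ x) = (not a ∷ x) ∷ map (a ∷_) (neighbours x)

find : ∀ {A : Set} {P : A → Set} → Decidable P → List A → Maybe (∃ P)
find P? xs = Maybe.map satisfied (dec⇒maybe (any? P? xs))

module EscapeSearch {n} (c r : Vertex n) where

  escape? : ∀ a b → Dec (Escape zeros c a b)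
  escape? a b = (hamming a b ℕ.≟ 1) ×-dec (2 ≤? hamming zeros b) ×-dec (2 ≤? hamming c b)

  step : (x : Vertex n) → Maybe (∃ (Escape zeros c x))
  step x = Maybe.map (map₂ proj₁) (find closer? (neighbours x)) <∣> find (escape? x) (neighbours x)
    where
    closer? : ∀ y → Dec (Escape zeros c x y × hamming y r < hamming x r)
    closer? y = escape? x y ×-dec (hamming y r <? hamming x r)

  walk : ℕ → (x : Vertex n) → Maybe (Star (Escape zeros c) x r)
  walk fuel x with x ≟ᵥ r
  ... | yes refl = just ε
  walk zero x | no _ = nothing
  walk (suc fuel) x | no _ = step x >>= λ (y , x→y) → Maybe.map (x→y ◅_) (walk fuel y)

-- 1⋯1 is far from 0; when it is near c, 110⋯0 is far from both.
root : ∀ {n} → Vertex (2 + n) → Vertex (2 + n)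
root c = if does (2 ≤? hamming c ones) then ones else true ∷ true ∷ zeros

WalksToRoot : ∀ {n} → Vertex (2 + n) → Vertex (2 + n) → Set
WalksToRoot c u = u ≢ zeros → u ≢ c → Is-just (EscapeSearch.walk c (root c) 14 u)

walksToRoot? : ∀ {n} (c u : Vertex (2 + n)) → Dec (WalksToRoot c u)
walksToRoot? c u =
  ¬? (u ≟ᵥ zeros) →-dec (¬? (u ≟ᵥ c) →-dec dec (λ _ → yes tt) (EscapeSearch.walk c (root c) 14 u))

escapable-by-search : ∀ {n} → (∀ (c u : Vertex (2 + n)) → WalksToRoot c u) → Escapable (2 + n)
escapable-by-search walks = escapable-from-origin λ c →
  root c , λ u u≢0 u≢c → to-witness (walks c u u≢0 u≢c)

escapable₅ : Escapable 5
escapable₅ = escapable-by-search (from-yes (all-vertices? {5} λ c → all-vertices? {P = WalksToRoot c} (walksToRoot? c)))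

escapable₆ : Escapable 6
escapable₆ = escapable-by-search (from-yes (all-vertices? {6} λ c → all-vertices? {P = WalksToRoot c} (walksToRoot? c)))

Survives : ∀ {n} → (Vertex n → Set) → Vertex n → Vertex n → Set
Survives R a b = Adj a b × ¬ R a × ¬ R b

module _ {n} (escapable : Escapable n) {R : Vertex n → Set} {c₁ c₂ : Vertex n}
         (R-near : ∀ x → R x → hamming c₁ x ≤ 1 ⊎ hamming c₂ x ≤ 1) where

  far⇒survives : ∀ {x} → Far c₁ x → Far c₂ x → ¬ R x
  far⇒survives far₁ far₂ Rx with R-near _ Rx
  ... | inj₁ near = ≤⇒≯ near far₁
  ... | inj₂ near = ≤⇒≯ near far₂

  escape⇒survives : ∀ {a b} → ¬ R a → Star (Escape c₁ c₂) a b → Star (Survives R) a b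
  escape⇒survives ¬Ra ε = ε
  escape⇒survives ¬Ra ((adj , far₁ , far₂) ◅ path) =
    (adj , ¬Ra , far⇒survives far₁ far₂) ◅ escape⇒survives (far⇒survives far₁ far₂) path

  joined-outside-balls : ∀ {u v} → ¬ R u → ¬ R v → u ≢ c₁ → u ≢ c₂ → v ≢ c₁ → v ≢ c₂
    → Star (Survives R) u v
  joined-outside-balls {u} {v} ¬Ru ¬Rv u≢c₁ u≢c₂ v≢c₁ v≢c₂ =
    escape⇒survives ¬Ru (reach u u≢c₁ u≢c₂) ◅◅ reverse flip (escape⇒survives ¬Rv (reach v v≢c₁ v≢c₂))
    where
    reach = proj₂ (escapable c₁ c₂)
    flip : ∀ {a b} → Survives R a b → Survives R b a
    flip {a} {b} (adj , ¬Ra , ¬Rb) = Adj-sym {x = a} {b} adj , ¬Rb , ¬Ra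

avoiding-vertex : ∀ {n} (u v : Vertex (2 + n)) → ∃[ c ] c ≢ u × c ≢ v
avoiding-vertex (a ∷ _ ∷ _) (_ ∷ b ∷ _) =
  not a ∷ not b ∷ zeros ,
  (λ eq → not-¬ refl (sym (∷-injectiveˡ eq))) ,
  (λ eq → not-¬ refl (sym (∷-injectiveˡ (∷-injectiveʳ eq))))

module FewSubgraphs {n} (escapable : Escapable (2 + n)) {S : Set} (V : S → Vertex (2 + n) → Set)
         (centre : S → Vertex (2 + n)) (centre∈ : ∀ s → V s (centre s))
         (near-centre : ∀ s x → V s x → hamming (centre s) x ≤ 1) where

  Removed : List S → Vertex (2 + n) → Set
  Removed F x = Any (λ s → V s x) F

  not-centre : ∀ {F s u} → s ∈ F → ¬ Removed F u → u ≢ centre s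
  not-centre s∈F ¬Ru refl = ¬Ru (Any.map (λ { refl → centre∈ _ }) s∈F)

  fewer-than-three-do-not-disconnect : ∀ F → length F < 3 → ¬ Disconnected (Removed F)
  fewer-than-three-do-not-disconnect [] _ (u , v , ¬Ru , ¬Rv , ¬path)
    with avoiding-vertex u v
  ... | c , c≢u , c≢v = ¬path (joined-outside-balls escapable {c₁ = c} {c} (λ _ ())
        ¬Ru ¬Rv (≢-sym c≢u) (≢-sym c≢u) (≢-sym c≢v) (≢-sym c≢v))
  fewer-than-three-do-not-disconnect (s ∷ []) _ (u , v , ¬Ru , ¬Rv , ¬path) =
    ¬path (joined-outside-balls escapable near ¬Ru ¬Rv u≢s u≢s v≢s v≢s)
    where
    near : ∀ x → Removed (s ∷ []) x → hamming (centre s) x ≤ 1 ⊎ hamming (centre s) x ≤ 1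
    near x (here p) = inj₁ (near-centre s x p)
    u≢s = not-centre (here refl) ¬Ru
    v≢s = not-centre (here refl) ¬Rv
  fewer-than-three-do-not-disconnect (s ∷ t ∷ []) _ (u , v , ¬Ru , ¬Rv , ¬path) =
    ¬path (joined-outside-balls escapable near ¬Ru ¬Rv
      (not-centre (here refl) ¬Ru) (not-centre (there (here refl)) ¬Ru)
      (not-centre (here refl) ¬Rv) (not-centre (there (here refl)) ¬Rv))
    where
    near : ∀ x → Removed (s ∷ t ∷ []) x → hamming (centre s) x ≤ 1 ⊎ hamming (centre t) x ≤ 1
    near x (here p) = inj₁ (near-centre s x p)
    near x (there (here p)) = inj₂ (near-centre t x p)
  fewer-than-three-do-not-disconnect (_ ∷ _ ∷ _ ∷ _) (s≤s (s≤s (s≤s ())))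

Isolates : ∀ {n} → (Vertex n → Set) → Vertex n → Vertex n → Set
Isolates R u v = ¬ R u × ¬ R v × u ≢ v × (∀ w → Adj u w → R w)

isolates? : ∀ {n} {R : Vertex n → Set} → Decidable R → ∀ u v → Dec (Isolates R u v)
isolates? R? u v = ¬? (R? u) ×-dec ¬? (R? v) ×-dec ¬? (u ≟ᵥ v)
  ×-dec all-vertices? (λ w → (hamming u w ℕ.≟ 1) →-dec R? w)

isolates⇒disconnected : ∀ {n} {R : Vertex n → Set} {u v} → Isolates R u v → Disconnected R
isolates⇒disconnected {u = u} {v} (¬Ru , ¬Rv , u≢v , cover) = u , v , ¬Ru , ¬Rv , no-path
  where
  no-path : ¬ Star (Survives _) u v
  no-path ε = u≢v refl
  no-path ((adj , _ , ¬Rw) ◅ _) = ¬Rw (cover _ adj)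

isolates-resp : ∀ {n} {R R′ : Vertex n → Set} {u v} → (∀ x → R x → R′ x) → (∀ x → R′ x → R x)
  → Isolates R u v → Isolates R′ u v
isolates-resp R⇒R′ R′⇒R (¬Ru , ¬Rv , u≢v , cover) =
  ¬Ru ∘ R′⇒R _ , ¬Rv ∘ R′⇒R _ , u≢v , λ w adj → R⇒R′ w (cover w adj)

InStar? : ∀ {n r} (s : StarSub n r) → Decidable (InStar s)
InStar? s x = (x ≟ᵥ center s) ⊎-dec any? (x ≟ᵥ_) (leaves s)

InStar-near : ∀ {n r} (s : StarSub n r) x → InStar s x → hamming (center s) x ≤ 1
InStar-near s x (inj₁ refl) rewrite hamming-self x = z≤n
InStar-near s x (inj₂ x∈leaves) = ≤-reflexive (All.lookup (adjacent s) x∈leaves)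

star : ∀ {n} (c : Vertex n) (ds : List (Fin n)) {_ : True (allPairs? (λ i j → ¬? (i Fin.≟ j)) ds)}
  → StarSub n (length ds)
star c ds {distinct} = record
  { center = c
  ; leaves = map (toggle c) ds
  ; distinct = Unique.map⁺ (toggle-injective c) (toWitness distinct)
  ; size = length-map (toggle c) ds
  ; adjacent = All.map⁺ (All.tabulate λ {i} _ → hamming-toggle c i)
  }

Covered : ∀ {n r} → List (StarSub n r) → Vertex n → Set
Covered F x = Any (λ s → InStar s x) F

Covered? : ∀ {n r} (F : List (StarSub n r)) → Decidable (Covered F)
Covered? F x = any? (λ s → InStar? s x) F

CentresApart : ∀ {n r} → List (StarSub n r) → Set
CentresApart = AllPairs (λ s t → ¬ InStar t (center s))

CentresApart? : ∀ {n r} (F : List (StarSub n r)) → Dec (CentresApart F)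
CentresApart? = allPairs? (λ s t → ¬? (InStar? t (center s)))

centresApart⇒distinct : ∀ {n r} {F : List (StarSub n r)} → CentresApart F
  → AllPairs (λ s t → ¬ SameSub s t) F
centresApart⇒distinct = AllPairs.map λ c∉t same → c∉t (proj₁ (proj₁ same _) (inj₁ refl))

asSubStar : ∀ {n k} → StarSub n k → SubStar n k
asSubStar s = _ , ≤-refl , s

κ≡3-and-κˢ≡3 : ∀ {n} → Escapable (2 + n) → (F : List (StarSub (2 + n) 5)) {u v : Vertex (2 + n)}
  → length F ≡ 3 → CentresApart F → Isolates (Covered F) u v
  → κStar≡ (2 + n) 5 3 × κˢStar≡ (2 + n) 5 3
κ≡3-and-κˢ≡3 escapable F three apart isolates =
    ( (F , three , centresApart⇒distinct apart , isolates⇒disconnected isolates)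
    , λ F′ _ → FewSubgraphs.fewer-than-three-do-not-disconnect escapable
        InStar center (λ _ → inj₁ refl) InStar-near F′ )
  , ( ( map asSubStar F , trans (length-map asSubStar F) three
      , AllPairs.map⁺ (centresApart⇒distinct apart)
      , isolates⇒disconnected (isolates-resp (λ _ → Any.map⁺) (λ _ → Any.map⁻) isolates) )
    , λ F′ _ → FewSubgraphs.fewer-than-three-do-not-disconnect escapable
        (InStar ∘ proj₂ ∘ proj₂) (center ∘ proj₂ ∘ proj₂) (λ _ → inj₁ refl) (InStar-near ∘ proj₂ ∘ proj₂) F′ )

stars₅ : List (StarSub 5 5)
stars₅ = star (basis (# 0) ⊕ basis (# 1)) (allFin 5)
       ∷ star (basis (# 2) ⊕ basis (# 3)) (allFin 5)
       ∷ star (basis (# 0) ⊕ basis (# 4)) (allFin 5)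
       ∷ []

stars₆ : List (StarSub 6 5)
stars₆ = star (basis (# 0) ⊕ basis (# 1)) (# 0 ∷ # 1 ∷ # 2 ∷ # 3 ∷ # 4 ∷ [])
       ∷ star (basis (# 2) ⊕ basis (# 3)) (# 1 ∷ # 2 ∷ # 3 ∷ # 4 ∷ # 5 ∷ [])
       ∷ star (basis (# 4) ⊕ basis (# 5)) (# 0 ∷ # 1 ∷ # 2 ∷ # 4 ∷ # 5 ∷ [])
       ∷ []

theorem4p6 : ∀ n → 5 ≤ n → n ≤ 6 → κStar≡ n 5 3 × κˢStar≡ n 5 3
theorem4p6 5 _ _ = κ≡3-and-κˢ≡3 escapable₅ stars₅ refl
  (from-yes (CentresApart? stars₅)) (from-yes (isolates? (Covered? stars₅) zeros ones))
theorem4p6 6 _ _ = κ≡3-and-κˢ≡3 escapable₆ stars₆ refl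
  (from-yes (CentresApart? stars₆)) (from-yes (isolates? (Covered? stars₆) zeros ones))
theorem4p6 0 () _
theorem4p6 1 (s≤s ()) _
theorem4p6 2 (s≤s (s≤s ())) _
theorem4p6 3 (s≤s (s≤s (s≤s ()))) _
theorem4p6 4 (s≤s (s≤s (s≤s (s≤s ())))) _
theorem4p6 (suc (suc (suc (suc (suc (suc (suc _))))))) _ (s≤s (s≤s (s≤s (s≤s (s≤s (s≤s ()))))))
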